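{- For any multisorted algebraic language $\mathcal{G}$ with no nullary symbols and finitely many sorts, the category $\mathsf{MSAlg}^+(\mathcal{G})$ of multisorted $\mathcal{G}$-algebras is equivalent to the category $\overline{\mathsf{DAlg}}^{\,+}(\hat{\mathcal{G}})$ of $\hat{\mathcal{G}}$-algebras. In more detail: (1) the functor $\mathfrak{P}$ maps the full subcategory $\mathsf{MSAlg}^+(\mathcal{G})$ of $\mathsf{MSAlg}(\mathcal{G})$ into the full subcategory $\mathsf{DAlg}^+(\hat{\mathcal{G}})$ of $\mathsf{Alg}(\hat{\mathcal{G}})$, and yields (by changing the domain and target categories) an isomorphism $\mathfrak{P}\colon\mathsf{MSAlg}^+(\mathcal{G})\to\mathsf{DAlg}^+(\hat{\mathcal{G}})$; (2) $\mathfrak{P}$ restricts to an isomorphism between the full subcategory $\mathsf{MSAlg}^\boxplus(\mathcal{G})$ of $\mathsf{MSAlg}^+(\mathcal{G})$ and the full subcategory $\mathsf{DAlg}^\boxplus(\hat{\mathcal{G}})$ of $\mathsf{DAlg}^+(\hat{\mathcal{G}})$.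
   Context: $\mathcal{G}$ is a multisorted algebraic language with no nullary symbols whose sorts are indexed by $[m]=\{1,\dots,m\}$, $m>0$. $\hat{\mathcal{G}}$ is the (single-sorted) language with an $m$-ary symbol $d$ and a symbol $\hat{g}$ with $\mathrm{ar}(\hat{g})=\mathrm{ar}(g)$ for each $g\in\mathcal{G}$. The functor $\mathfrak{P}\colon\mathsf{MSAlg}(\mathcal{G})\to\mathsf{Alg}(\hat{\mathcal{G}})$ sends a multisorted algebra $\mathbf{M}=((M^{(i)})_{i\in[m]};\mathcal{G})$ to the $\hat{\mathcal{G}}$-algebra on $M^{(1)}\times\dots\times M^{(m)}$ in which $d$ is the diagonal operation $d((a_1^{(i)})_i,\dots,(a_m^{(i)})_i)=(a_1^{(1)},\dots,a_m^{(m)})$, and for $g\in\mathcal{G}$ with input sorts $(i_1,\dots,i_k)$ and output sort $i'$, $\hat{g}((a_1^{(i)})_i,\dots,(a_k^{(i)})_i)$ is the tuple $(a_1^{(1)},\dots,a_1^{(m)})$ with its $i'$-th entry replaced by $g(a_1^{(i_1)},\dots,a_k^{(i_k)})$; it sends a homomorphism $\zeta=(\zeta^{(i)})_{i\in[m]}$ to $\zeta^{(1)}\times\dots\times\zeta^{(m)}$. $\mathsf{MSAlg}^+(\mathcal{G})$ is the full subcategory of multisorted $\mathcal{G}$-algebras with all sorts nonempty, and $\mathsf{MSAlg}^\boxplus(\mathcal{G})$ its full subcategory where the sorts are moreover pairwise disjoint. $\mathsf{DAlg}^+(\hat{\mathcal{G}})$ is the full subcategory of $\mathsf{Alg}(\hat{\mathcal{G}})$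 whose objects are the algebras $\mathfrak{P}(\mathbf{M})$ with all sorts of $\mathbf{M}$ nonempty, and $\mathsf{DAlg}^\boxplus(\hat{\mathcal{G}})$ its full subcategory of those $\mathfrak{P}(\mathbf{M})$ with pairwise disjoint sorts. $\overline{\mathsf{DAlg}}^{\,+}(\hat{\mathcal{G}})$ is the full subcategory of $\mathsf{Alg}(\hat{\mathcal{G}})$ whose objects are the nonempty members of the variety $\mathcal{D}(\hat{\mathcal{G}})$ of all isomorphic copies of algebras of the form $\mathfrak{P}(\mathbf{M})$. -}

module Defs where

open import Data.Nat using (ℕ; zero; suc; _<_)
open import Data.Fin using (Fin; zero; suc; fromℕ<)
open import Data.Fin.Properties using (_≟_)
open import Data.Vec using (Vec; []; _∷_; lookup; tabulate; map; _[_]≔_)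
open import Data.Vec.Properties using (lookup∘tabulate; lookup-map; lookup∘update; lookup∘update′)
open import Data.Maybe using (Maybe; just; nothing)
open import Data.Product using (Σ; Σ-syntax; _×_; _,_; proj₁; proj₂)
open import Relation.Nullary using (yes; no)
open import Relation.Binary.PropositionalEquality
  using (_≡_; refl; sym; trans; cong; cong₂; subst)

-- All algebras live inside an ambient type; a carrier (or a sort) is a
-- subset of the ambient type, given as a predicate.  An operation of
-- arity k is represented by a function on k-tuples (vectors) of the
-- ambient type; only its values on tuples of carrier elements matter.
-- Equality of objects / morphisms is the extensional (set-theoretic)
-- equality: same elements, same values on elements.

record Lang : Set₁ where
  field
    Op    : Set
    arity : Op → ℕ

record MSLang (m : ℕ) : Set₁ where
  field
    Sym     : Set
    ar      : Sym → ℕ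
    ar-pos  : ∀ g → 0 < ar g
    inSort  : (g : Sym) → Fin (ar g) → Fin m
    outSort : Sym → Fin m

AllIn : ∀ {W : Set} {k} → (W → Set) → Vec W k → Set
AllIn C ts = ∀ j → C (lookup ts j)

module _ (L : Lang) where
  open Lang L

  record Alg (W : Set) : Set₁ where
    field
      C      : W → Set
      op     : (f : Op) → Vec W (arity f) → W
      closed : ∀ f (ts : Vec W (arity f)) → AllIn C ts → C (op f ts)

  open Alg

  record Hom {W W' : Set} (A : Alg W) (B : Alg W') : Set where
    field
      fun  : W → W'
      pres : ∀ x → C A x → C B (fun x)
      comm : ∀ f (ts : Vec W (arity f)) → AllIn (C A) ts →
             fun (op A f ts) ≡ op B f (map fun ts)

  open Hom

  HomEq : ∀ {W W'} {A : Alg W} {B : Alg W'} → Hom A B → Hom A B → Set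
  HomEq {A = A} h h' = ∀ x → C A x → fun h x ≡ fun h' x

  idHom : ∀ {W} (A : Alg W) → Hom A A
  idHom A = record
    { fun = λ x → x
    ; pres = λ x p → p
    ; comm = λ f ts _ → cong (op A f) (sym (map-id ts)) }
    where
    map-id : ∀ {k} (ts : Vec _ k) → map (λ x → x) ts ≡ ts
    map-id [] = refl
    map-id (t ∷ ts) = cong (t ∷_) (map-id ts)

  compHom : ∀ {W₁ W₂ W₃} {A : Alg W₁} {B : Alg W₂} {D : Alg W₃} →
            Hom B D → Hom A B → Hom A D
  compHom {A = A} {B} {D} k h = record
    { fun = λ x → fun k (fun h x)
    ; pres = λ x p → pres k _ (pres h x p)
    ; comm = λ f ts p →
        trans (cong (fun k) (comm h f ts p))
          (trans (comm k f (map (fun h) ts)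
                   (λ j → subst (C B) (sym (lookup-map j (fun h) ts))
                                 (pres h _ (p j))))
                 (cong (op D f) (map-∘ ts))) }
    where
    map-∘ : ∀ {k'} (ts : Vec _ k') → map (fun k) (map (fun h) ts) ≡ map (λ x → fun k (fun h x)) ts
    map-∘ [] = refl
    map-∘ (t ∷ ts) = cong (_ ∷_) (map-∘ ts)

  AlgEq : ∀ {W} → Alg W → Alg W → Set
  AlgEq A B = (∀ x → (C A x → C B x) × (C B x → C A x))
            × (∀ f (ts : Vec _ (arity f)) → AllIn (C A) ts → op A f ts ≡ op B f ts)

  AlgIso : ∀ {W W'} → Alg W → Alg W' → Set
  AlgIso A B = Σ (Hom A B) λ h → Σ (Hom B A) λ k →
               HomEq (compHom k h) (idHom A) × HomEq (compHom h k) (idHom B)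

  NonemptyAlg : ∀ {W} → Alg W → Set
  NonemptyAlg {W} A = Σ W (C A)

-- The language Ĝ: d (= nothing, arity m) and ĝ (= just g, arity ar g).

hat : ∀ {m} → MSLang m → Lang
hat {m} G = record { Op = Maybe Sym ; arity = arity }
  where
  open MSLang G
  arity : Maybe Sym → ℕ
  arity nothing  = m
  arity (just g) = ar g

vext : ∀ {A : Set} {n} (xs ys : Vec A n) → (∀ i → lookup xs i ≡ lookup ys i) → xs ≡ ys
vext [] [] _ = refl
vext (x ∷ xs) (y ∷ ys) e = cong₂ _∷_ (e zero) (vext xs ys (λ i → e (suc i)))

module _ {m : ℕ} (G : MSLang m) where
  open MSLang G

  record MSAlg (U : Set) : Set₁ where
    field
      S      : Fin m → U → Set
      op     : (g : Sym) → Vec U (ar g) → U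
      closed : ∀ g (xs : Vec U (ar g)) →
               (∀ j → S (inSort g j) (lookup xs j)) → S (outSort g) (op g xs)

  open MSAlg

  WellSorted : ∀ {U} → MSAlg U → (g : Sym) → Vec U (ar g) → Set
  WellSorted M g xs = ∀ j → S M (inSort g j) (lookup xs j)

  record MSHom {U : Set} (M N : MSAlg U) : Set where
    field
      fun  : Fin m → U → U
      pres : ∀ i x → S M i x → S N i (fun i x)
      comm : ∀ g (xs : Vec U (ar g)) → WellSorted M g xs →
             fun (outSort g) (op M g xs)
               ≡ op N g (tabulate (λ j → fun (inSort g j) (lookup xs j)))

  open MSHom

  MSHomEq : ∀ {U} {M N : MSAlg U} → MSHom M N → MSHom M N → Set
  MSHomEq {M = M} ζ ζ' = ∀ i x → S M i x → fun ζ i x ≡ fun ζ' i x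

  msId : ∀ {U} (M : MSAlg U) → MSHom M M
  msId M = record
    { fun = λ i x → x
    ; pres = λ i x p → p
    ; comm = λ g xs _ → cong (op M g) (vext _ _ (λ j → sym (lookup∘tabulate _ j))) }

  msComp : ∀ {U} {M N K : MSAlg U} → MSHom N K → MSHom M N → MSHom M K
  msComp {M = M} {N} {K} ξ ζ = record
    { fun = λ i x → fun ξ i (fun ζ i x)
    ; pres = λ i x p → pres ξ i _ (pres ζ i x p)
    ; comm = λ g xs p →
        trans (cong (fun ξ (outSort g)) (comm ζ g xs p))
          (trans (comm ξ g _ (λ j → subst (S N (inSort g j))
                                   (sym (lookup∘tabulate _ j))
                                   (pres ζ _ _ (p j))))
                 (cong (op K g) (vext _ _ (λ j →
                    trans (lookup∘tabulate _ j)
                      (trans (cong (fun ξ (inSort g j)) (lookup∘tabulate _ j))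
                             (sym (lookup∘tabulate _ j))))))) }

  MSAlgEq : ∀ {U} → MSAlg U → MSAlg U → Set
  MSAlgEq {U} M N = (∀ i (x : U) → (S M i x → S N i x) × (S N i x → S M i x))
                  × (∀ g xs → WellSorted M g xs → op M g xs ≡ op N g xs)

  Nonempty : ∀ {U} → MSAlg U → Set
  Nonempty {U} M = ∀ i → Σ U (S M i)

  Disjoint : ∀ {U} → MSAlg U → Set
  Disjoint {U} M = ∀ i j (x : U) → S M i x → S M j x → i ≡ j

  NonemptyDisjoint : ∀ {U} → MSAlg U → Set
  NonemptyDisjoint M = Nonempty M × Disjoint M

  first : ∀ {k} → 0 < k → Fin k
  first {k} p = fromℕ< p

  -- 𝔓 on objects: carrier M^(1) × … × M^(m) ⊆ Vec U m
  P : ∀ {U} → MSAlg U → Alg (hat G) (Vec U m)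
  P {U} M = record { C = Car ; op = opP ; closed = cl }
    where
    Car : Vec U m → Set
    Car t = ∀ i → S M i (lookup t i)
    args : (g : Sym) → Vec (Vec U m) (ar g) → Vec U (ar g)
    args g ts = tabulate (λ j → lookup (lookup ts j) (inSort g j))
    opP : (f : Maybe Sym) → Vec (Vec U m) (Lang.arity (hat G) f) → Vec U m
    opP nothing  ts = tabulate (λ i → lookup (lookup ts i) i)
    opP (just g) ts = lookup ts (first (ar-pos g)) [ outSort g ]≔ op M g (args g ts)
    cl : ∀ f ts → AllIn Car ts → Car (opP f ts)
    cl nothing ts p i =
      subst (S M i) (sym (lookup∘tabulate (λ i₁ → lookup (lookup ts i₁) i₁) i)) (p i i)
    cl (just g) ts p i with i ≟ outSort g
    ... | yes refl = subst (S M i) (sym (lookup∘update i (lookup ts (first (ar-pos g))) (op M g (args g ts))))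
                       (closed M g (args g ts) (λ j → subst (S M (inSort g j))
                          (sym (lookup∘tabulate (λ j₁ → lookup (lookup ts j₁) (inSort g j₁)) j))
                          (p j (inSort g j))))
    ... | no i≢o = subst (S M i)
                       (sym (lookup∘update′ i≢o (lookup ts (first (ar-pos g))) (op M g (args g ts))))
                       (p (first (ar-pos g)) i)

  PHom : ∀ {U} {M N : MSAlg U} → MSHom M N → Hom (hat G) (P M) (P N)
  PHom {U} {M} {N} ζ = record { fun = F ; pres = pr ; comm = cm }
    where
    F : Vec U m → Vec U m
    F t = tabulate (λ i → fun ζ i (lookup t i))
    lF : ∀ t i → lookup (F t) i ≡ fun ζ i (lookup t i)
    lF t i = lookup∘tabulate (λ i₁ → fun ζ i₁ (lookup t i₁)) i
    pr : ∀ t → Alg.C (P M) t → Alg.C (P N) (F t)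
    pr t p i = subst (S N i) (sym (lF t i)) (pres ζ i _ (p i))
    argsM : (g : Sym) → Vec (Vec U m) (ar g) → Vec U (ar g)
    argsM g ts = tabulate (λ j → lookup (lookup ts j) (inSort g j))
    lA : ∀ g ts j → lookup (argsM g ts) j ≡ lookup (lookup ts j) (inSort g j)
    lA g ts j = lookup∘tabulate (λ j₁ → lookup (lookup ts j₁) (inSort g j₁)) j
    lmF : ∀ {k} (ts : Vec (Vec U m) k) j i → lookup (lookup (map F ts) j) i ≡ fun ζ i (lookup (lookup ts j) i)
    lmF ts j i = trans (cong (λ v → lookup v i) (lookup-map j F ts)) (lF (lookup ts j) i)
    cm : ∀ f ts → AllIn (Alg.C (P M)) ts →
         F (Alg.op (P M) f ts) ≡ Alg.op (P N) f (map F ts)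
    cm nothing ts p = vext _ _ λ i →
      trans (lF (tabulate (λ i₁ → lookup (lookup ts i₁) i₁)) i)
        (trans (cong (fun ζ i) (lookup∘tabulate (λ i₁ → lookup (lookup ts i₁) i₁) i))
          (sym (trans (lookup∘tabulate (λ i₁ → lookup (lookup (map F ts) i₁) i₁) i)
                      (lmF ts i i))))
    cm (just g) ts p = vext _ _ go
      where
      o = outSort g
      f1 = first (ar-pos g)
      x = op M g (argsM g ts)
      y = op N g (argsM g (map F ts))
      ws : WellSorted M g (argsM g ts)
      ws j = subst (S M (inSort g j)) (sym (lA g ts j)) (p j (inSort g j))
      go : ∀ i → lookup (F (lookup ts f1 [ o ]≔ x)) i ≡ lookup (lookup (map F ts) f1 [ o ]≔ y) i
      go i with i ≟ o
      ... | yes refl =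
        trans (lF (lookup ts f1 [ o ]≔ x) i)
          (trans (cong (fun ζ i) (lookup∘update i (lookup ts f1) x))
            (trans (comm ζ g (argsM g ts) ws)
              (trans (cong (op N g) (vext _ _ λ j →
                  trans (lookup∘tabulate (λ j₁ → fun ζ (inSort g j₁) (lookup (argsM g ts) j₁)) j)
                   (trans (cong (fun ζ (inSort g j)) (lA g ts j))
                    (sym (trans (lA g (map F ts) j) (lmF ts j (inSort g j)))))))
                (sym (lookup∘update i (lookup (map F ts) f1) y)))))
      ... | no i≢o =
        trans (lF (lookup ts f1 [ o ]≔ x) i)
          (trans (cong (fun ζ i) (lookup∘update′ i≢o (lookup ts f1) x))
            (sym (trans (lookup∘update′ i≢o (lookup (map F ts) f1) y) (lmF ts f1 i))))

  IsDAlg⁺ : ∀ {U} → Alg (hat G) (Vec U m) → Set₁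
  IsDAlg⁺ {U} A = Σ (MSAlg U) λ M → Nonempty M × AlgEq (hat G) A (P M)

  IsDAlg⊞ : ∀ {U} → Alg (hat G) (Vec U m) → Set₁
  IsDAlg⊞ {U} A = Σ (MSAlg U) λ M → NonemptyDisjoint M × AlgEq (hat G) A (P M)

  InD : ∀ {W} → Alg (hat G) W → Set₁
  InD A = Σ Set λ U → Σ (MSAlg U) λ M → AlgIso (hat G) A (P M)

  record IsFunctorP (U : Set) : Set₁ where
    field
      obj-resp  : ∀ (M N : MSAlg U) → MSAlgEq M N → AlgEq (hat G) (P M) (P N)
      hom-resp  : ∀ {M N : MSAlg U} (ζ ζ' : MSHom M N) →
                  MSHomEq ζ ζ' → HomEq (hat G) (PHom ζ) (PHom ζ')
      pres-id   : ∀ (M : MSAlg U) → HomEq (hat G) (PHom (msId M)) (idHom (hat G) (P M))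
      pres-comp : ∀ {M N K : MSAlg U} (ξ : MSHom N K) (ζ : MSHom M N) →
                  HomEq (hat G) (PHom (msComp ξ ζ)) (compHom (hat G) (PHom ξ) (PHom ζ))

  -- 𝔓, with domain restricted to the full subcategory of MSAlg(G) given
  -- by MSob and codomain the full subcategory of Alg(Ĝ) given by Dob,
  -- is an isomorphism of categories: well-defined on objects, bijective
  -- on objects, bijective on every hom-set.
  record IsIsoP (U : Set) (MSob : MSAlg U → Set)
                (Dob : Alg (hat G) (Vec U m) → Set₁) : Set₁ where
    field
      obj-into : ∀ M → MSob M → Dob (P M)
      obj-onto : ∀ A → Dob A → Σ (MSAlg U) λ M → MSob M × AlgEq (hat G) (P M) A
      obj-inj  : ∀ M N → MSob M → MSob N → AlgEq (hat G) (P M) (P N) → MSAlgEq M N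
      faithful : ∀ M N → MSob M → MSob N → (ζ ζ' : MSHom M N) →
                 HomEq (hat G) (PHom ζ) (PHom ζ') → MSHomEq ζ ζ'
      full     : ∀ M N → MSob M → MSob N → (h : Hom (hat G) (P M) (P N)) →
                 Σ (MSHom M N) λ ζ → HomEq (hat G) (PHom ζ) h

  -- Every object of the closure DAlg‾⁺(Ĝ) (nonempty members of 𝒟(Ĝ))
  -- is isomorphic to 𝔓(M) for some M in MSAlg⁺(G) (essential surjectivity;
  -- together with IsIsoP for MSAlg⁺ this gives the equivalence, since
  -- DAlg‾⁺ is a full subcategory of Alg(Ĝ) containing DAlg⁺).
  EssSurjBar : Set₁
  EssSurjBar = ∀ (W : Set) (A : Alg (hat G) W) → InD A → NonemptyAlg (hat G) A →
               Σ Set λ U → Σ (MSAlg U) λ M → Nonempty M × AlgIso (hat G) (P M) A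

-- A homomorphism h between algebras 𝔓(M), 𝔓(N) acts coordinatewise: applying
-- the diagonal operation d to the tuple (s, …, s, t, s, …, s), with t in
-- position i, returns s when tᵢ = sᵢ, so (h t)ᵢ = (h s)ᵢ. Once every sort of M
-- is nonempty, each x ∈ M⁽ⁱ⁾ embeds into 𝔓(M) by completing it with fixed
-- witnesses in the other coordinates; reading off the i-th coordinate of h on
-- these embedded elements gives the multisorted homomorphism ζ with 𝔓(ζ) = h,
-- and the same embedding recovers the sorts and operations of M from 𝔓(M).
module Submission where

open import Defs
open import Data.Nat using (ℕ; _<_)
open import Data.Fin using (Fin)
open import Data.Fin.Properties using (_≟_)
open import Data.Maybe using (just; nothing)
open import Data.Product using (Σ; _×_; _,_; proj₁; proj₂)
open import Data.Vec using (Vec; lookup; tabulate; map; replicate; _[_]≔_)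
open import Data.Vec.Properties
  using (lookup∘tabulate; lookup-map; lookup∘update; lookup∘update′; lookup-replicate; tabulate∘lookup)
open import Relation.Nullary using (yes; no)
open import Relation.Binary.PropositionalEquality
open ≡-Reasoning

module _ (L : Lang) where
  open Hom

  AlgEq-sym : ∀ {W} {A B : Alg L W} → AlgEq L A B → AlgEq L B A
  AlgEq-sym (C⇔ , op≡) =
    (λ x → proj₂ (C⇔ x) , proj₁ (C⇔ x)) ,
    (λ f ts ts∈ → sym (op≡ f ts (λ j → proj₂ (C⇔ _) (ts∈ j))))

  AlgEq-refl : ∀ {W} (A : Alg L W) → AlgEq L A A
  AlgEq-refl A = (λ x → (λ p → p) , (λ p → p)) , (λ f ts _ → refl)

  AlgIso-sym : ∀ {W W'} {A : Alg L W} {B : Alg L W'} → AlgIso L A B → AlgIso L B A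
  AlgIso-sym (h , k , kh≈id , hk≈id) = k , h , hk≈id , kh≈id

  Hom-nonempty : ∀ {W W'} {A : Alg L W} {B : Alg L W'} →
                 Hom L A B → NonemptyAlg L A → NonemptyAlg L B
  Hom-nonempty h (a , a∈) = fun h a , pres h a a∈

module _ {m : ℕ} (G : MSLang m) {U : Set} where
  open MSLang G
  open MSAlg
  open MSHom
  open Hom

  private
    𝔓 : MSAlg G U → Alg (hat G) (Vec U m)
    𝔓 = P G

  open Alg using (C)

  args : (g : Sym) → Vec (Vec U m) (ar g) → Vec U (ar g)
  args g ts = tabulate (λ j → lookup (lookup ts j) (inSort g j))

  lookup-P-out : ∀ (M : MSAlg G U) g ts →
                 lookup (Alg.op (𝔓 M) (just g) ts) (outSort g) ≡ op M g (args g ts)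
  lookup-P-out M g ts = lookup∘update (outSort g) (lookup ts (first G (ar-pos g))) _

  P-nonempty⇒Nonempty : ∀ (M : MSAlg G U) → NonemptyAlg (hat G) (𝔓 M) → Nonempty G M
  P-nonempty⇒Nonempty M (t , t∈) i = lookup t i , t∈ i

  Hom-coordinatewise : ∀ {M N : MSAlg G U} (h : Hom (hat G) (𝔓 M) (𝔓 N)) {t s} →
                       C (𝔓 M) t → C (𝔓 M) s → ∀ i → lookup t i ≡ lookup s i →
                       lookup (fun h t) i ≡ lookup (fun h s) i
  Hom-coordinatewise {M} {N} h {t} {s} t∈ s∈ i tᵢ≡sᵢ = sym (begin
    lookup (fun h s) i                                    ≡⟨ cong (λ v → lookup (fun h v) i) (sym d[ts]≡s) ⟩
    lookup (fun h (Alg.op (𝔓 M) nothing ts)) i            ≡⟨ cong (λ v → lookup v i) (comm h nothing ts ts∈) ⟩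
    lookup (Alg.op (𝔓 N) nothing (map (fun h) ts)) i      ≡⟨ lookup∘tabulate _ i ⟩
    lookup (lookup (map (fun h) ts) i) i                  ≡⟨ cong (λ v → lookup v i) (lookup-map i (fun h) ts) ⟩
    lookup (fun h (lookup ts i)) i                        ≡⟨ cong (λ v → lookup (fun h v) i) (lookup∘update i (replicate m s) t) ⟩
    lookup (fun h t) i                                    ∎)
    where
    ts : Vec (Vec U m) m
    ts = replicate m s [ i ]≔ t
    lookup-ts : ∀ {j} → j ≢ i → lookup ts j ≡ s
    lookup-ts {j} j≢i = trans (lookup∘update′ j≢i (replicate m s) t) (lookup-replicate j s)
    ts∈ : AllIn (C (𝔓 M)) ts
    ts∈ j with j ≟ i
    ... | yes refl = subst (C (𝔓 M)) (sym (lookup∘update j (replicate m s) t)) t∈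
    ... | no j≢i   = subst (C (𝔓 M)) (sym (lookup-ts j≢i)) s∈
    diagonal : ∀ j → lookup (lookup ts j) j ≡ lookup s j
    diagonal j with j ≟ i
    ... | yes refl = trans (cong (λ v → lookup v j) (lookup∘update j (replicate m s) t)) tᵢ≡sᵢ
    ... | no j≢i   = cong (λ v → lookup v j) (lookup-ts j≢i)
    d[ts]≡s : Alg.op (𝔓 M) nothing ts ≡ s
    d[ts]≡s = vext _ _ (λ j → trans (lookup∘tabulate _ j) (diagonal j))

  module Embedding (M : MSAlg G U) (ne : Nonempty G M) where
    base : Vec U m
    base = tabulate (λ i → proj₁ (ne i))

    ι : Fin m → U → Vec U m
    ι i x = base [ i ]≔ x

    lookup-ι : ∀ i x → lookup (ι i x) i ≡ x
    lookup-ι i x = lookup∘update i base x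

    ι-∈ : ∀ {i x} → S M i x → C (𝔓 M) (ι i x)
    ι-∈ {i} {x} x∈ j with j ≟ i
    ... | yes refl = subst (S M j) (sym (lookup-ι j x)) x∈
    ... | no j≢i   = subst (S M j) (sym (trans (lookup∘update′ j≢i base x) (lookup∘tabulate _ j)))
                           (proj₂ (ne j))

    ι-args : (g : Sym) → Vec U (ar g) → Vec (Vec U m) (ar g)
    ι-args g xs = tabulate (λ j → ι (inSort g j) (lookup xs j))

    ι-args-∈ : ∀ g xs → WellSorted G M g xs → AllIn (C (𝔓 M)) (ι-args g xs)
    ι-args-∈ g xs ws j = subst (C (𝔓 M)) (sym (lookup∘tabulate _ j)) (ι-∈ (ws j))

    args-ι-args : ∀ g xs → args g (ι-args g xs) ≡ xs
    args-ι-args g xs = vext _ _ λ j → begin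
      lookup (args g (ι-args g xs)) j                     ≡⟨ lookup∘tabulate _ j ⟩
      lookup (lookup (ι-args g xs) j) (inSort g j)        ≡⟨ cong (λ v → lookup v (inSort g j)) (lookup∘tabulate _ j) ⟩
      lookup (ι (inSort g j) (lookup xs j)) (inSort g j)  ≡⟨ lookup-ι (inSort g j) (lookup xs j) ⟩
      lookup xs j                                         ∎

  P-reflects-AlgEq : ∀ (M N : MSAlg G U) → Nonempty G M → Nonempty G N →
                     AlgEq (hat G) (𝔓 M) (𝔓 N) → MSAlgEq G M N
  P-reflects-AlgEq M N neM neN (C⇔ , op≡) = sorts , ops
    where
    module EM = Embedding M neM
    module EN = Embedding N neN
    sorts : ∀ i x → (S M i x → S N i x) × (S N i x → S M i x)
    sorts i x =
      (λ x∈ → subst (S N i) (EM.lookup-ι i x) (proj₁ (C⇔ (EM.ι i x)) (EM.ι-∈ x∈) i)) ,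
      (λ x∈ → subst (S M i) (EN.lookup-ι i x) (proj₂ (C⇔ (EN.ι i x)) (EN.ι-∈ x∈) i))
    ops : ∀ g xs → WellSorted G M g xs → op M g xs ≡ op N g xs
    ops g xs ws = begin
      op M g xs                                               ≡⟨ cong (op M g) (sym (EM.args-ι-args g xs)) ⟩
      op M g (args g ts)                                      ≡⟨ sym (lookup-P-out M g ts) ⟩
      lookup (Alg.op (𝔓 M) (just g) ts) (outSort g)          ≡⟨ cong (λ v → lookup v (outSort g)) (op≡ (just g) ts (EM.ι-args-∈ g xs ws)) ⟩
      lookup (Alg.op (𝔓 N) (just g) ts) (outSort g)          ≡⟨ lookup-P-out N g ts ⟩
      op N g (args g ts)                                      ≡⟨ cong (op N g) (EM.args-ι-args g xs) ⟩
      op N g xs                                               ∎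
      where ts = EM.ι-args g xs

  P-faithful : ∀ {M N : MSAlg G U} → Nonempty G M → (ζ ζ' : MSHom G M N) →
               HomEq (hat G) (PHom G ζ) (PHom G ζ') → MSHomEq G ζ ζ'
  P-faithful {M} neM ζ ζ' Pζ≈Pζ' i x x∈ = begin
    fun ζ i x                                 ≡⟨ cong (fun ζ i) (sym (lookup-ι i x)) ⟩
    fun ζ i (lookup (ι i x) i)                ≡⟨ sym (lookup∘tabulate _ i) ⟩
    lookup (fun (PHom G ζ) (ι i x)) i         ≡⟨ cong (λ v → lookup v i) (Pζ≈Pζ' (ι i x) (ι-∈ x∈)) ⟩
    lookup (fun (PHom G ζ') (ι i x)) i        ≡⟨ lookup∘tabulate _ i ⟩
    fun ζ' i (lookup (ι i x) i)               ≡⟨ cong (fun ζ' i) (lookup-ι i x) ⟩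
    fun ζ' i x                                ∎
    where open Embedding M neM

  module Preimage {M N : MSAlg G U} (neM : Nonempty G M) (h : Hom (hat G) (𝔓 M) (𝔓 N)) where
    open Embedding M neM

    component : Fin m → U → U
    component i x = lookup (fun h (ι i x)) i

    component-comm : ∀ g xs → WellSorted G M g xs →
                     component (outSort g) (op M g xs)
                       ≡ op N g (tabulate (λ j → component (inSort g j) (lookup xs j)))
    component-comm g xs ws = begin
      lookup (fun h (ι o (op M g xs))) o                  ≡⟨ Hom-coordinatewise h (ι-∈ (closed M g xs ws)) ĝts∈ o same-out ⟩
      lookup (fun h (Alg.op (𝔓 M) (just g) ts)) o         ≡⟨ cong (λ v → lookup v o) (comm h (just g) ts ts∈) ⟩
      lookup (Alg.op (𝔓 N) (just g) (map (fun h) ts)) o   ≡⟨ lookup-P-out N g (map (fun h) ts) ⟩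
      op N g (args g (map (fun h) ts))                    ≡⟨ cong (op N g) (vext _ _ args-h) ⟩
      op N g (tabulate (λ j → component (inSort g j) (lookup xs j))) ∎
      where
      o = outSort g
      ts = ι-args g xs
      ts∈ = ι-args-∈ g xs ws
      ĝts∈ : C (𝔓 M) (Alg.op (𝔓 M) (just g) ts)
      ĝts∈ = Alg.closed (𝔓 M) (just g) ts ts∈
      same-out : lookup (ι o (op M g xs)) o ≡ lookup (Alg.op (𝔓 M) (just g) ts) o
      same-out = begin
        lookup (ι o (op M g xs)) o                ≡⟨ lookup-ι o (op M g xs) ⟩
        op M g xs                                 ≡⟨ cong (op M g) (sym (args-ι-args g xs)) ⟩
        op M g (args g ts)                        ≡⟨ sym (lookup-P-out M g ts) ⟩
        lookup (Alg.op (𝔓 M) (just g) ts) o      ∎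
      args-h : ∀ j → lookup (args g (map (fun h) ts)) j
                     ≡ lookup (tabulate (λ j → component (inSort g j) (lookup xs j))) j
      args-h j = begin
        lookup (args g (map (fun h) ts)) j                     ≡⟨ lookup∘tabulate _ j ⟩
        lookup (lookup (map (fun h) ts) j) (inSort g j)        ≡⟨ cong (λ v → lookup v (inSort g j)) (lookup-map j (fun h) ts) ⟩
        lookup (fun h (lookup ts j)) (inSort g j)              ≡⟨ cong (λ v → lookup (fun h v) (inSort g j)) (lookup∘tabulate _ j) ⟩
        component (inSort g j) (lookup xs j)                   ≡⟨ sym (lookup∘tabulate _ j) ⟩
        lookup (tabulate (λ j → component (inSort g j) (lookup xs j))) j ∎

    ζ : MSHom G M N
    ζ = record
      { fun  = component
      ; pres = λ i x x∈ → pres h (ι i x) (ι-∈ x∈) i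
      ; comm = component-comm }

    Pζ≈h : HomEq (hat G) (PHom G ζ) h
    Pζ≈h t t∈ = vext _ _ λ i →
      trans (lookup∘tabulate _ i)
            (Hom-coordinatewise h (ι-∈ (t∈ i)) t∈ i (lookup-ι i (lookup t i)))

  P-full : ∀ {M N : MSAlg G U} → Nonempty G M → (h : Hom (hat G) (𝔓 M) (𝔓 N)) →
           Σ (MSHom G M N) λ ζ → HomEq (hat G) (PHom G ζ) h
  P-full neM h = ζ , Pζ≈h
    where open Preimage neM h

  P-isFunctor : IsFunctorP G U
  P-isFunctor = record
    { obj-resp  = λ M N M≈N →
        (λ t → (λ t∈ i → proj₁ (proj₁ M≈N i _) (t∈ i)) , (λ t∈ i → proj₂ (proj₁ M≈N i _) (t∈ i))) ,
        op-resp M N M≈N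
    ; hom-resp  = λ ζ ζ' ζ≈ζ' t t∈ → vext _ _ λ i →
        trans (lookup∘tabulate _ i) (trans (ζ≈ζ' i _ (t∈ i)) (sym (lookup∘tabulate _ i)))
    ; pres-id   = λ M t _ → tabulate∘lookup t
    ; pres-comp = λ ξ ζ t _ → vext _ _ λ i →
        trans (lookup∘tabulate _ i)
              (trans (cong (fun ξ i) (sym (lookup∘tabulate _ i))) (sym (lookup∘tabulate _ i)))
    }
    where
    op-resp : ∀ M N → MSAlgEq G M N → ∀ f ts → AllIn (C (𝔓 M)) ts →
              Alg.op (𝔓 M) f ts ≡ Alg.op (𝔓 N) f ts
    op-resp M N M≈N nothing  ts ts∈ = refl
    op-resp M N M≈N (just g) ts ts∈ =
      cong (lookup ts (first G (ar-pos g)) [ outSort g ]≔_)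
           (proj₂ M≈N g _ (λ j → subst (S M (inSort g j)) (sym (lookup∘tabulate _ j)) (ts∈ j (inSort g j))))

  P-isIso : (Ob : MSAlg G U → Set) → (∀ M → Ob M → Nonempty G M) →
            IsIsoP G U Ob (λ A → Σ (MSAlg G U) λ M → Ob M × AlgEq (hat G) A (𝔓 M))
  P-isIso Ob nonempty = record
    { obj-into = λ M obM → M , obM , AlgEq-refl (hat G) (𝔓 M)
    ; obj-onto = λ A (M , obM , A≈PM) → M , obM , AlgEq-sym (hat G) {A = A} {B = 𝔓 M} A≈PM
    ; obj-inj  = λ M N obM obN → P-reflects-AlgEq M N (nonempty M obM) (nonempty N obN)
    ; faithful = λ M N obM _ → P-faithful (nonempty M obM)
    ; full     = λ M N obM _ → P-full (nonempty M obM)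
    }

P-essSurj : ∀ {m} (G : MSLang m) → EssSurjBar G
P-essSurj G W A (U , M , A≅PM) A-ne =
  U , M , P-nonempty⇒Nonempty G M (Hom-nonempty (hat G) (proj₁ A≅PM) A-ne) ,
  AlgIso-sym (hat G) A≅PM

theorem2p7 : ∀ {m : ℕ} → 0 < m → (G : MSLang m) →
    EssSurjBar G
    × ((U : Set) →
         IsFunctorP G U
         × IsIsoP G U (Nonempty G) (IsDAlg⁺ G)
         × IsIsoP G U (NonemptyDisjoint G) (IsDAlg⊞ G))
theorem2p7 _ G = P-essSurj G , λ U →
  P-isFunctor G , P-isIso G (Nonempty G) (λ _ ne → ne) , P-isIso G (NonemptyDisjoint G) (λ _ → proj₁)
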